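{- For any $r\ge2$ and $s\ge1$: $\mathrm{Ex}(\mathrm{dbl}(\mathrm{Perm}_{r,s+1}),n,m)\le r\cdot\mathrm{PERM}^{\mathrm{dbl}}_{r,s}(n,m)+2rn$ and $\mathrm{Ex}(\mathrm{dbl}(\mathrm{Perm}_{r,s+1}),n)=O(\mathrm{PERM}^{\mathrm{dbl}}_{r,s}(n))$.
   Context: Sequences are finite words; $\sigma\prec S$ means some subsequence of $S$ is isomorphic (equal up to renaming letters) to $\sigma$; $S$ is $P$-free for a set $P$ if $\sigma\not\prec S$ for all $\sigma\in P$. A sequence is $k$-sparse if equal letters are at distance at least $k$. A block is a sequence of distinct symbols. For a set $P$ of sequences over an $r$-letter alphabet, $\mathrm{Ex}(P,n)$ is the maximum length of an $r$-sparse $P$-free sequence over an $n$-letter alphabet, and $\mathrm{Ex}(P,n,m)$ is the maximum length of a $P$-free sequence over an $n$-letter alphabet partitionable into at most $m$ blocks. $\mathrm{Perm}_{r,s+1}$ is the set of concatenations of $s+1$ permutations of $[r]$. $\mathrm{dbl}(\sigma)$ doubles every letter of $\sigma$ except the first and the last; $\mathrm{dbl}(\mathrm{Perm}_{r,s+1})=\{\mathrm{dbl}(\sigma):\sigma\in\mathrm{Perm}_{r,s+1}\}$. $\mathrm{Perm}^{\mathrm{dbl}}_{r,s+1}$ is the set of sequences over $[r]$ of the form $\sigma_1\cdots\sigma_{s+1}$, $\sigma_1,\sigma_{s+1}$ permutations of $[r]$ and each $\sigma_2,\dots,\sigma_s$ containing exactly two occurrences of every symbol of $[r]$. $\mathrm{PERM}^{\mathrm{dbl}}_{r,s}(n)=\mathrm{Ex}(\mathrm{Perm}^{\mathrm{dbl}}_{r,s+1},n)$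 and $\mathrm{PERM}^{\mathrm{dbl}}_{r,s}(n,m)=\mathrm{Ex}(\mathrm{Perm}^{\mathrm{dbl}}_{r,s+1},n,m)$. -}

module Defs where

open import Data.Nat using (ℕ; zero; suc; _≤_; _<_; _∸_)
open import Data.Fin using (Fin; toℕ)
open import Data.List using (List; []; _∷_; _++_; concat; length; map; lookup; allFin)
open import Data.List.Relation.Unary.All using (All)
open import Data.List.Relation.Unary.Unique.Propositional using (Unique)
open import Data.List.Relation.Binary.Sublist.Propositional using (_⊆_)
open import Data.List.Relation.Binary.Permutation.Propositional using (_↭_)
open import Data.Product using (Σ; ∃; _×_)
open import Function.Definitions using (Injective)
open import Relation.Binary.PropositionalEquality using (_≡_)
open import Relation.Nullary using (¬_)

PatternSet : ℕ → Set₁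
PatternSet r = List (Fin r) → Set

_≺_ : ∀ {r n} → List (Fin r) → List (Fin n) → Set
_≺_ {r} {n} σ S = Σ (Fin r → Fin n) λ f → Injective _≡_ _≡_ f × (map f σ ⊆ S)

Free : ∀ {r n} → PatternSet r → List (Fin n) → Set
Free {r} P S = (σ : List (Fin r)) → P σ → ¬ (σ ≺ S)

Sparse : ∀ {n} → ℕ → List (Fin n) → Set
Sparse k S = (i j : Fin (length S)) → toℕ i < toℕ j →
             lookup S i ≡ lookup S j → k ≤ toℕ j ∸ toℕ i

Blocks : ∀ {n} → ℕ → List (Fin n) → Set
Blocks {n} m S = Σ (List (List (Fin n))) λ L →
  (length L ≤ m) × All Unique L × (concat L ≡ S)

ExSparseBound : (r : ℕ) → PatternSet r → ℕ → ℕ → Set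
ExSparseBound r P n K = (S : List (Fin n)) → Sparse r S → Free P S → length S ≤ K

ExBlocksBound : ∀ {r} → PatternSet r → ℕ → ℕ → ℕ → Set
ExBlocksBound P n m K = (S : List (Fin n)) → Blocks m S → Free P S → length S ≤ K

IsPerm : ∀ {r} → List (Fin r) → Set
IsPerm {r} σ = σ ↭ allFin r

IsTwice : ∀ {r} → List (Fin r) → Set
IsTwice {r} σ = σ ↭ (allFin r ++ allFin r)

Perm : (r k : ℕ) → PatternSet r
Perm r k σ = Σ (List (List (Fin r))) λ L → (length L ≡ k) × All IsPerm L × (concat L ≡ σ)

dblTail : ∀ {A : Set} → List A → List A
dblTail [] = []
dblTail (y ∷ []) = y ∷ []
dblTail (y ∷ z ∷ zs) = y ∷ y ∷ dblTail (z ∷ zs)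

dbl : ∀ {A : Set} → List A → List A
dbl [] = []
dbl (x ∷ xs) = x ∷ dblTail xs

DblPerm : (r k : ℕ) → PatternSet r
DblPerm r k τ = ∃ λ σ → Perm r k σ × (τ ≡ dbl σ)

PermDbl : (r s : ℕ) → PatternSet r
PermDbl r s τ = Σ (List (Fin r)) λ σ₁ → Σ (List (List (Fin r))) λ mids → Σ (List (Fin r)) λ σₗ →
  IsPerm σ₁ × IsPerm σₗ × (length mids ≡ s ∸ 1) × All IsTwice mids ×
  (τ ≡ σ₁ ++ concat mids ++ σₗ)

module Submission where

-- Write r = k+1 and let S avoid dbl(Perm_{r,s+1}).  Scan S greedily and keep an occurrence of a
-- letter a only if at least k occurrences of a lie between it and the previously kept occurrence
-- of a (or the start of S) and at least k further occurrences of a follow.  Let K be the kept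
-- subsequence.  If K contained a pattern σ₁σ₂⋯σ_{s+1} of Perm^dbl_{r,s+1}, then in the segment of S
-- spanned by each σᵢ every letter would occur ≥ k+1 times (≥ k+2 for the middle blocks, which keep
-- each letter twice), and that suffices to extract x·double(π₁), double(πᵢ) and double(π_{s+1})·y,
-- i.e. a pattern dbl(π₁⋯π_{s+1}) of dbl(Perm_{r,s+1}) in S; so K avoids Perm^dbl_{r,s+1}.  Per
-- letter, every kept occurrence accounts for at most k+1 occurrences, up to 2k in total, so
-- |S| ≤ r|K| + 2kn; as a subsequence, K inherits partitions into blocks: the first bound.  For
-- sparse S the scan also refuses ("blocks") a letter that is among the last k kept ones, which
-- makes K r-sparse; sparseness of S bounds runs of blocked occurrences by k, so
-- |S| ≤ r·(#unblocked) + k, and with n ≤ PERM^dbl_{r,s}(n) this gives a constant factor.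

open import Defs
open import Algebra.Properties.CommutativeSemigroup using (interchange)
open import Data.Empty using (⊥-elim)
open import Data.Fin using (Fin; toℕ) renaming (zero to fzero; suc to fsuc)
import Data.Fin.Properties as FinP
open FinP using (_≟_)
open import Data.List using (List; []; _∷_; _++_; concat; length; map; filter; allFin; reverse; _ʳ++_; take; lookup; [_])
open import Data.List.Properties
  using (length-++; length-map; length-reverse; length-take; length-tabulate; map-++; concat-++; ++-assoc; ++-identityʳ;
         reverse-++; unfold-reverse; reverse-map; reverse-involutive;
         filter-++; filter-accept; filter-reject; filter-some; filter-none)
open import Data.List.Membership.Propositional using (_∈_; find; lose)
open import Data.List.Membership.Propositional.Properties using (∈-allFin; ∈-∃++)
open import Data.List.Relation.Binary.Permutation.Propositional using (_↭_; ↭-refl; ↭-sym; ↭-trans; prep; ↭⇒↭ₛ)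
import Data.List.Relation.Binary.Permutation.Propositional.Properties as PermP
open PermP using (∈-resp-↭)
import Data.List.Relation.Binary.Permutation.Setoid.Properties as PermS
open import Data.List.Relation.Binary.Sublist.Propositional using (_⊆_; []; _∷_; _∷ʳ_; from∈; minimum)
import Data.List.Relation.Binary.Sublist.Propositional.Properties as SubP
open import Data.List.Relation.Unary.All as All using (All; []; _∷_)
import Data.List.Relation.Unary.All.Properties as AllP
open AllP using (all-filter)
open import Data.List.Relation.Unary.All.Properties.Core using (¬Any⇒All¬)
open import Data.List.Relation.Unary.AllPairs using ([]; _∷_)
open import Data.List.Relation.Unary.Any using (Any; here; there; any?)
open import Data.List.Relation.Unary.Unique.Propositional using (Unique)
import Data.List.Relation.Unary.Unique.Propositional.Properties as UniqueP
open UniqueP using (allFin⁺)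
open import Data.Nat using (ℕ; zero; suc; _≤_; _<_; _+_; _*_; _∸_; z≤n; s≤s; _≤?_; _<?_)
open import Data.Nat.Properties hiding (_≟_)
open import Data.Nat.Tactic.RingSolver using (solve-∀)
open import Data.Product using (Σ; ∃; ∃₂; _×_; _,_; proj₁; proj₂)
open import Data.Vec.Functional using (updateAt)
open import Data.Vec.Functional.Properties using (updateAt-updates; updateAt-minimal)
open import Function.Base using (_∘_)
open import Function.Definitions using (Injective)
open import Relation.Binary.PropositionalEquality
  using (setoid; _≡_; _≢_; refl; sym; trans; cong; cong₂; subst; subst₂; module ≡-Reasoning)
open import Relation.Nullary using (¬_; yes; no)
open import Relation.Nullary.Decidable using (_×-dec_)

occ : ∀ {n} → Fin n → List (Fin n) → ℕ
occ y xs = length (filter (y ≟_) xs)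

module _ {n : ℕ} where

  occ-here : ∀ (y : Fin n) xs → occ y (y ∷ xs) ≡ suc (occ y xs)
  occ-here y xs = cong length (filter-accept (y ≟_) refl)

  occ-there : ∀ {y a : Fin n} xs → y ≢ a → occ y (a ∷ xs) ≡ occ y xs
  occ-there {y} xs y≢a = cong length (filter-reject (y ≟_) y≢a)

  occ-++ : ∀ (y : Fin n) xs ys → occ y (xs ++ ys) ≡ occ y xs + occ y ys
  occ-++ y xs ys = trans (cong length (filter-++ (y ≟_) xs ys)) (length-++ (filter (y ≟_) xs))

  occ-cut : ∀ {y z : Fin n} B C → y ≢ z → occ y (B ++ z ∷ C) ≡ occ y B + occ y C
  occ-cut {y} B C y≢z = trans (occ-++ y B (_ ∷ C)) (cong (occ y B +_) (occ-there C y≢z))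

  occ-⊆ : ∀ (y : Fin n) {xs ys} → xs ⊆ ys → occ y xs ≤ occ y ys
  occ-⊆ y xs⊆ys = SubP.length-mono-≤ (SubP.filter⁺ (y ≟_) (y ≟_) (λ { refl p → p }) xs⊆ys)

  occ-↭ : ∀ (y : Fin n) {xs ys} → xs ↭ ys → occ y xs ≡ occ y ys
  occ-↭ y xs↭ys = PermP.↭-length (PermP.filter-↭ (y ≟_) xs↭ys)

  occ-∈ : ∀ {y : Fin n} {xs} → y ∈ xs → 1 ≤ occ y xs
  occ-∈ {y} y∈xs = filter-some (y ≟_) y∈xs

  ∈-occ : ∀ {y : Fin n} xs → 1 ≤ occ y xs → y ∈ xs
  ∈-occ {y} xs 1≤occ with any? (y ≟_) xs
  ... | yes y∈xs = y∈xs
  ... | no y∉xs = ⊥-elim (1+n≰n (subst (1 ≤_) (cong length (filter-none (y ≟_) (¬Any⇒All¬ xs y∉xs))) 1≤occ))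

  occ-unique : ∀ (y : Fin n) {xs} → Unique xs → occ y xs ≤ 1
  occ-unique y {xs} u = atMostOne (UniqueP.filter⁺ (y ≟_) u) (all-filter (y ≟_) xs)
    where
    atMostOne : ∀ {zs} → Unique zs → All (y ≡_) zs → length zs ≤ 1
    atMostOne [] _ = z≤n
    atMostOne (_ ∷ []) _ = s≤s z≤n
    atMostOne ((a≢b ∷ _) ∷ _) (refl ∷ refl ∷ _) = ⊥-elim (a≢b refl)

occ-map : ∀ {r n} (f : Fin r → Fin n) → Injective _≡_ _≡_ f → ∀ x xs → occ (f x) (map f xs) ≡ occ x xs
occ-map f f-inj x [] = refl
occ-map f f-inj x (a ∷ xs) with x ≟ a
... | yes refl = trans (occ-here (f x) (map f xs)) (cong suc (occ-map f f-inj x xs))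
... | no x≢a = trans (occ-there (map f xs) (x≢a ∘ f-inj)) (occ-map f f-inj x xs)

occ-allFin : ∀ {r} (x : Fin r) → occ x (allFin r) ≡ 1
occ-allFin {r} x = ≤-antisym (occ-unique x (allFin⁺ r)) (occ-∈ (∈-allFin x))

length-allFin : ∀ r → length (allFin r) ≡ r
length-allFin r = length-tabulate (λ i → i)

occ-perm : ∀ {r} {σ : List (Fin r)} → IsPerm σ → ∀ x → occ x σ ≡ 1
occ-perm p x = trans (occ-↭ x p) (occ-allFin x)

occ-twice : ∀ {r} {σ : List (Fin r)} → IsTwice σ → ∀ x → occ x σ ≡ 2
occ-twice {r} p x = trans (occ-↭ x p) (trans (occ-++ x (allFin r) (allFin r)) (cong₂ _+_ (occ-allFin x) (occ-allFin x)))

∑ : (n : ℕ) → (Fin n → ℕ) → ℕ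
∑ zero g = 0
∑ (suc n) g = g fzero + ∑ n (g ∘ fsuc)

∑-mono : ∀ n {g h : Fin n → ℕ} → (∀ i → g i ≤ h i) → ∑ n g ≤ ∑ n h
∑-mono zero g≤h = z≤n
∑-mono (suc n) g≤h = +-mono-≤ (g≤h fzero) (∑-mono n (g≤h ∘ fsuc))

∑-cong : ∀ n {g h : Fin n → ℕ} → (∀ i → g i ≡ h i) → ∑ n g ≡ ∑ n h
∑-cong zero g≡h = refl
∑-cong (suc n) g≡h = cong₂ _+_ (g≡h fzero) (∑-cong n (g≡h ∘ fsuc))

∑-+ : ∀ n (g h : Fin n → ℕ) → ∑ n (λ i → g i + h i) ≡ ∑ n g + ∑ n h
∑-+ zero g h = refl
∑-+ (suc n) g h = trans (cong (g fzero + h fzero +_) (∑-+ n (g ∘ fsuc) (h ∘ fsuc)))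
  (interchange +-commutativeSemigroup (g fzero) (h fzero) (∑ n (g ∘ fsuc)) (∑ n (h ∘ fsuc)))

∑-*ˡ : ∀ n c (g : Fin n → ℕ) → ∑ n (λ i → c * g i) ≡ c * ∑ n g
∑-*ˡ zero c g = sym (*-zeroʳ c)
∑-*ˡ (suc n) c g = trans (cong (c * g fzero +_) (∑-*ˡ n c (g ∘ fsuc))) (sym (*-distribˡ-+ c (g fzero) _))

∑-const : ∀ n c → ∑ n (λ _ → c) ≡ n * c
∑-const zero c = refl
∑-const (suc n) c = cong (c +_) (∑-const n c)

∑-occ : ∀ {n} (xs : List (Fin n)) → ∑ n (λ y → occ y xs) ≡ length xs
∑-occ {n} [] = trans (∑-const n 0) (*-zeroʳ n)
∑-occ {n} (a ∷ xs) = trans (∑-cong n (λ y → occ-++ y [ a ] xs))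
  (trans (∑-+ n _ _) (cong₂ _+_ (∑-singleton a) (∑-occ xs)))
  where
  ∑-singleton : ∀ {n} (a : Fin n) → ∑ n (λ y → occ y [ a ]) ≡ 1
  ∑-singleton {suc n} fzero = cong suc (trans (∑-cong n absent) (trans (∑-const n 0) (*-zeroʳ n)))
    where
    absent : ∀ y → occ (fsuc y) [ fzero ] ≡ 0
    absent y = occ-there {y = fsuc y} {fzero} [] λ ()
  ∑-singleton {suc n} (fsuc a) = cong₂ _+_ (occ-there {y = fzero} {fsuc a} [] λ ()) (trans (∑-cong n shifted) (∑-singleton a))
    where
    shifted : ∀ y → occ (fsuc y) [ fsuc a ] ≡ occ y [ a ]
    shifted y = occ-map fsuc FinP.suc-injective y [ a ]

pigeonhole : ∀ {n} {xs ys : List (Fin n)} → Unique xs → (∀ {x} → x ∈ xs → x ∈ ys) → length xs ≤ length ys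
pigeonhole {n} {xs} {ys} u xs⊆ys = subst₂ _≤_ (∑-occ xs) (∑-occ ys) (∑-mono n pointwise)
  where
  pointwise : ∀ y → occ y xs ≤ occ y ys
  pointwise y with occ y xs in eq
  ... | zero = z≤n
  ... | suc _ = subst (_≤ occ y ys) eq (≤-trans (occ-unique y u) (occ-∈ (xs⊆ys y∈xs)))
    where
    y∈xs : y ∈ xs
    y∈xs = ∈-occ xs (subst (1 ≤_) (sym eq) (s≤s z≤n))

Unique-resp-↭ : ∀ {A : Set} {xs ys : List A} → xs ↭ ys → Unique xs → Unique ys
Unique-resp-↭ {A} p = PermS.Unique-resp-↭ (setoid A) (↭⇒↭ₛ p)

extract : ∀ {A : Set} {x : A} {xs} → x ∈ xs → ∃ λ rest → xs ↭ x ∷ rest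
extract {x = x} x∈xs with ys , zs , refl ← ∈-∃++ x∈xs = ys ++ zs , PermP.shift x ys zs

map-++₃ : ∀ {A B : Set} (g : A → B) xs ys zs → map g (xs ++ ys ++ zs) ≡ map g xs ++ map g ys ++ map g zs
map-++₃ g xs ys zs = trans (map-++ g xs (ys ++ zs)) (cong (map g xs ++_) (map-++ g ys zs))

double : ∀ {A : Set} → List A → List A
double [] = []
double (x ∷ xs) = x ∷ x ∷ double xs

double-++ : ∀ {A : Set} (xs ys : List A) → double (xs ++ ys) ≡ double xs ++ double ys
double-++ [] ys = refl
double-++ (x ∷ xs) ys = cong (λ t → x ∷ x ∷ t) (double-++ xs ys)

double-reverse : ∀ {A : Set} (xs : List A) → reverse (double xs) ≡ double (reverse xs)
double-reverse [] = refl
double-reverse (x ∷ xs) = begin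
    reverse (x ∷ x ∷ double xs)
  ≡⟨ reverse-++ (x ∷ x ∷ []) (double xs) ⟩
    reverse (double xs) ++ double [ x ]
  ≡⟨ cong (_++ double [ x ]) (double-reverse xs) ⟩
    double (reverse xs) ++ double [ x ]
  ≡⟨ sym (double-++ (reverse xs) [ x ]) ⟩
    double (reverse xs ++ [ x ])
  ≡⟨ cong double (sym (unfold-reverse x xs)) ⟩
    double (reverse (x ∷ xs)) ∎
  where open ≡-Reasoning

dbl-ends : ∀ {A : Set} (x : A) w y → dbl (x ∷ (w ++ [ y ])) ≡ x ∷ (double w ++ [ y ])
dbl-ends x w y = cong (x ∷_) (dblTail-snoc w)
  where
  dblTail-snoc : ∀ w → dblTail (w ++ [ y ]) ≡ double w ++ [ y ]
  dblTail-snoc [] = refl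
  dblTail-snoc (w ∷ []) = refl
  dblTail-snoc (w ∷ w′ ∷ ws) = cong (λ t → w ∷ w ∷ t) (dblTail-snoc (w′ ∷ ws))

dbl-blocks : ∀ {A : Set} (x : A) a b c y →
  dbl ((x ∷ a) ++ b ++ (c ++ [ y ])) ≡ (x ∷ double a) ++ double b ++ (double c ++ [ y ])
dbl-blocks x a b c y = begin
    dbl (x ∷ (a ++ b ++ (c ++ [ y ])))
  ≡⟨ cong (λ t → dbl (x ∷ t)) regroup ⟩
    dbl (x ∷ ((a ++ b ++ c) ++ [ y ]))
  ≡⟨ dbl-ends x (a ++ b ++ c) y ⟩
    x ∷ (double (a ++ b ++ c) ++ [ y ])
  ≡⟨ cong (λ t → x ∷ (t ++ [ y ])) (trans (double-++ a (b ++ c)) (cong (double a ++_) (double-++ b c))) ⟩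
    x ∷ ((double a ++ double b ++ double c) ++ [ y ])
  ≡⟨ cong (x ∷_) (trans (++-assoc (double a) _ [ y ]) (cong (double a ++_) (++-assoc (double b) (double c) [ y ]))) ⟩
    (x ∷ double a) ++ double b ++ (double c ++ [ y ]) ∎
  where
  open ≡-Reasoning
  regroup : a ++ b ++ (c ++ [ y ]) ≡ (a ++ b ++ c) ++ [ y ]
  regroup = sym (trans (++-assoc a (b ++ c) [ y ]) (cong (a ++_) (++-assoc b c [ y ])))

perm-blocks : ∀ {r} s → 1 ≤ s → (first : List (Fin r)) (πs : List (List (Fin r))) (last : List (Fin r)) →
  IsPerm first → All IsPerm πs → IsPerm last → length πs ≡ s ∸ 1 → Perm r (suc s) (first ++ concat πs ++ last)
perm-blocks s s≥1 first πs last p-first p-πs p-last len =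
  first ∷ πs ++ [ last ] , cong suc lengths , p-first ∷ AllP.++⁺ p-πs (p-last ∷ []) , cong (first ++_) concats
  where
  lengths : length (πs ++ [ last ]) ≡ s
  lengths = trans (length-++ πs) (trans (cong (_+ 1) len) (m∸n+n≡m s≥1))
  concats : concat (πs ++ [ last ]) ≡ concat πs ++ last
  concats = trans (sym (concat-++ πs [ last ])) (cong (concat πs ++_) (++-identityʳ last))

module Extraction {r n : ℕ} (f : Fin r → Fin n) (f-inj : Injective _≡_ _≡_ f) where

  firstOccurrence : ∀ (xs : List (Fin r)) A → (∃ λ x → x ∈ xs × 1 ≤ occ (f x) A) →
    ∃ λ x → x ∈ xs × ∃₂ λ B C → A ≡ B ++ f x ∷ C × (∀ x′ → x′ ∈ xs → occ (f x′) B ≡ 0)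
  firstOccurrence xs [] (_ , _ , ())
  firstOccurrence xs (a ∷ A) _ with any? (λ x → f x ≟ a) xs
  ... | yes found with x , x∈xs , refl ← find found = x , x∈xs , [] , A , refl , λ _ _ → refl
  firstOccurrence xs (a ∷ A) (x₀ , x₀∈xs , occ≥1) | no absent
    with x , x∈xs , B , C , refl , none ←
           firstOccurrence xs A (x₀ , x₀∈xs , subst (1 ≤_) (occ-there A (absent ∘ lose x₀∈xs)) occ≥1)
    = x , x∈xs , a ∷ B , C , refl , λ x′ x′∈xs → trans (occ-there B (absent ∘ lose x′∈xs)) (none x′ x′∈xs)

  appendUnseen : ∀ {xs : List (Fin r)} P a → ¬ Any (λ x → f x ≡ a × 1 ≤ occ (f x) P) xs →
    (∀ x′ → x′ ∈ xs → occ (f x′) P ≤ 1) → ∀ x′ → x′ ∈ xs → occ (f x′) (P ++ [ a ]) ≤ 1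
  appendUnseen P a absent atMostOnce x′ x′∈xs rewrite occ-++ (f x′) P [ a ] with f x′ ≟ a
  ... | no _ = subst (_≤ 1) (sym (+-identityʳ _)) (atMostOnce x′ x′∈xs)
  ... | yes fx′≡a with 1 ≤? occ (f x′) P
  ...   | yes seen = ⊥-elim (absent (lose x′∈xs (fx′≡a , seen)))
  ...   | no unseen = +-monoˡ-≤ 1 (≤-pred (≰⇒> unseen))

  firstRepeat : ∀ (xs : List (Fin r)) P A → (∀ x′ → x′ ∈ xs → occ (f x′) P ≤ 1) →
    (∃ λ x → x ∈ xs × 2 ≤ occ (f x) (P ++ A)) →
    ∃ λ x → x ∈ xs × ∃₂ λ B C → P ++ A ≡ B ++ f x ∷ C × 1 ≤ occ (f x) B ×
                                (∀ x′ → x′ ∈ xs → occ (f x′) B ≤ 1)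
  firstRepeat xs P [] atMostOnce (x , x∈xs , twice) =
    ⊥-elim (<⇒≱ twice (subst (λ t → occ (f x) t ≤ 1) (sym (++-identityʳ P)) (atMostOnce x x∈xs)))
  firstRepeat xs P (a ∷ A) atMostOnce _ with any? (λ x → (f x ≟ a) ×-dec (1 ≤? occ (f x) P)) xs
  ... | yes found with x , x∈xs , refl , seen ← find found = x , x∈xs , P , A , refl , seen , atMostOnce
  firstRepeat xs P (a ∷ A) atMostOnce (x₀ , x₀∈xs , twice) | no absent
    with x , x∈xs , B , C , eq , seen , rest ←
           firstRepeat xs (P ++ [ a ]) A (appendUnseen P a absent atMostOnce)
             (x₀ , x₀∈xs , subst (λ t → 2 ≤ occ (f x₀) t) (sym (++-assoc P [ a ] A)) twice)
    = x , x∈xs , B , C , trans (sym (++-assoc P [ a ] A)) eq , seen , rest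

  removal : ∀ {x : Fin r} {xs rest} → Unique xs → xs ↭ x ∷ rest →
    Unique rest × (∀ {x′} → x′ ∈ rest → x′ ∈ xs × f x′ ≢ f x)
  removal u xs↭ with x∉rest ∷ u-rest ← Unique-resp-↭ xs↭ u =
    u-rest , λ x′∈rest →
      ∈-resp-↭ (↭-sym xs↭) (there x′∈rest) , λ fx′≡fx → All.lookup x∉rest x′∈rest (sym (f-inj fx′≡fx))

  -- Cut A at the first second occurrence of a letter x: the two occurrences of x start
  -- double π, every other letter occurred at most once before the cut, so k times after it.
  doubledPermutation : ∀ k (xs : List (Fin r)) A → length xs ≡ k → Unique xs →
    (∀ x → x ∈ xs → suc k ≤ occ (f x) A) → ∃ λ π → π ↭ xs × map f (double π) ⊆ A
  doubledPermutation zero [] A _ _ _ = [] , ↭-refl , minimum A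
  doubledPermutation (suc k) (x₀ ∷ xs₀) A len u often
    with x , x∈xs , B , C , refl , seen , atMostOnce ←
           firstRepeat (x₀ ∷ xs₀) [] A (λ _ _ → z≤n)
             (x₀ , here refl , ≤-trans (s≤s (s≤s z≤n)) (often x₀ (here refl)))
    with rest , xs↭ ← extract x∈xs
    = let π , π↭ , embedded = doubledPermutation k rest C lengthRest (proj₁ (removal u xs↭)) oftenRest
      in x ∷ π , ↭-trans (prep x π↭) (↭-sym xs↭) , SubP.++⁺ (from∈ (∈-occ B seen)) (refl ∷ embedded)
    where
    lengthRest : length rest ≡ k
    lengthRest = suc-injective (trans (sym (PermP.↭-length xs↭)) len)
    oftenRest : ∀ x′ → x′ ∈ rest → suc k ≤ occ (f x′) C
    oftenRest x′ x′∈rest with x′∈xs , fx′≢fx ← proj₂ (removal u xs↭) x′∈rest =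
      +-cancelˡ-≤ 1 _ _ (≤-trans (often x′ x′∈xs)
        (≤-trans (≤-reflexive (occ-cut B C fx′≢fx)) (+-monoˡ-≤ _ (atMostOnce x′ x′∈xs))))

  -- If the k+1 letters of xs occur at least k+1 times each, A contains f(x ∷ double π) for a
  -- permutation x ∷ π of xs: x is the first letter to occur, the others occur k+1 times after it.
  leadingDoubled : ∀ k (xs : List (Fin r)) A → length xs ≡ suc k → Unique xs →
    (∀ x → x ∈ xs → suc k ≤ occ (f x) A) → ∃₂ λ x π → x ∷ π ↭ xs × map f (x ∷ double π) ⊆ A
  leadingDoubled k (x₀ ∷ xs₀) A len u often
    with x , x∈xs , B , C , refl , none ←
           firstOccurrence (x₀ ∷ xs₀) A (x₀ , here refl , ≤-trans (s≤s z≤n) (often x₀ (here refl)))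
    with rest , xs↭ ← extract x∈xs
    = let π , π↭ , embedded = doubledPermutation k rest C lengthRest (proj₁ (removal u xs↭)) oftenRest
      in x , π , ↭-trans (prep x π↭) (↭-sym xs↭) , SubP.++⁺ˡ B (refl ∷ embedded)
    where
    lengthRest : length rest ≡ k
    lengthRest = suc-injective (trans (sym (PermP.↭-length xs↭)) len)
    oftenRest : ∀ x′ → x′ ∈ rest → suc k ≤ occ (f x′) C
    oftenRest x′ x′∈rest with x′∈xs , fx′≢fx ← proj₂ (removal u xs↭) x′∈rest =
      ≤-trans (often x′ x′∈xs) (≤-reflexive (trans (occ-cut B C fx′≢fx) (cong (_+ occ (f x′) C) (none x′ x′∈xs))))

  trailingDoubled : ∀ k (xs : List (Fin r)) A → length xs ≡ suc k → Unique xs →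
    (∀ x → x ∈ xs → suc k ≤ occ (f x) A) → ∃₂ λ π x → π ++ [ x ] ↭ xs × map f (double π ++ [ x ]) ⊆ A
  trailingDoubled k xs A len u often
    with x , π , x∷π↭ , embedded ← leadingDoubled k xs (reverse A) len u
           (λ x x∈xs → subst (suc k ≤_) (sym (occ-↭ (f x) (PermP.↭-reverse A))) (often x x∈xs))
    = reverse π , x , reverse-↭ , subst₂ _⊆_ reversed (reverse-involutive A) (SubP.reverse⁺ embedded)
    where
    reverse-↭ : reverse π ++ [ x ] ↭ xs
    reverse-↭ = ↭-trans (subst (_↭ x ∷ π) (unfold-reverse x π) (PermP.↭-reverse (x ∷ π))) x∷π↭
    reversed : reverse (map f (x ∷ double π)) ≡ map f (double (reverse π) ++ [ x ])
    reversed = begin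
        reverse (map f (x ∷ double π))
      ≡⟨ sym (reverse-map f (x ∷ double π)) ⟩
        map f (reverse (x ∷ double π))
      ≡⟨ cong (map f) (unfold-reverse x (double π)) ⟩
        map f (reverse (double π) ++ [ x ])
      ≡⟨ cong (λ t → map f (t ++ [ x ])) (double-reverse π) ⟩
        map f (double (reverse π) ++ [ x ]) ∎
      where open ≡-Reasoning

-- Fresh w xs : no letter of xs reoccurs among the w letters following it.  This is (w+1)-sparseness
-- (see sparse⇒fresh and fresh⇒sparse), phrased so that it can be built letter by letter.
data Fresh {A : Set} (w : ℕ) : List A → Set where
  [] : Fresh w []
  _∷_ : ∀ {a xs} → ¬ a ∈ take w xs → Fresh w xs → Fresh w (a ∷ xs)

fresh-0 : ∀ {A : Set} (xs : List A) → Fresh 0 xs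
fresh-0 [] = []
fresh-0 (a ∷ xs) = (λ ()) ∷ fresh-0 xs

fresh-suffix : ∀ {A : Set} {w} (xs : List A) {ys} → Fresh w (xs ʳ++ ys) → Fresh w ys
fresh-suffix [] fresh = fresh
fresh-suffix (x ∷ xs) fresh with _ ∷ fresh-ys ← fresh-suffix xs fresh = fresh-ys

fresh-unique : ∀ {A : Set} w {xs : List A} → Unique xs → Fresh w xs
fresh-unique w [] = []
fresh-unique w {a ∷ xs} (a∉xs ∷ u) =
  (λ a∈ → All.lookup a∉xs (SubP.Any-resp-⊆ (SubP.take-⊆ w xs) a∈) refl) ∷ fresh-unique w u

∈-take-middle : ∀ {A : Set} {a : A} u v w → length u < w → a ∈ take w (u ++ a ∷ v)
∈-take-middle [] v (suc w) _ = here refl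
∈-take-middle (x ∷ u) v (suc w) (s≤s u<w) = there (∈-take-middle u v w u<w)

∈-take-split : ∀ {A : Set} {a : A} w xs → a ∈ take w xs → ∃₂ λ u v → xs ≡ u ++ a ∷ v × length u < w
∈-take-split (suc w) (x ∷ xs) (here refl) = [] , xs , refl , s≤s z≤n
∈-take-split (suc w) (x ∷ xs) (there a∈) with u , v , refl , u<w ← ∈-take-split w xs a∈ = x ∷ u , v , refl , s≤s u<w

-- Fresh w xs says: xs has no factor a m a with |m| < w. That formulation is symmetric.
CloseRepeat : ∀ {A : Set} → ℕ → List A → Set
CloseRepeat {A} w xs = Σ (List A) λ u → Σ A λ a → ∃₂ λ m v → xs ≡ u ++ a ∷ m ++ a ∷ v × length m < w

fresh⇒¬closeRepeat : ∀ {A : Set} {w} {xs : List A} → Fresh w xs → ¬ CloseRepeat w xs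
fresh⇒¬closeRepeat (a∉ ∷ _) ([] , a , m , v , refl , m<w) = a∉ (∈-take-middle m v _ m<w)
fresh⇒¬closeRepeat (_ ∷ fresh) (x ∷ u , a , m , v , refl , m<w) = fresh⇒¬closeRepeat fresh (u , a , m , v , refl , m<w)

¬closeRepeat⇒fresh : ∀ {A : Set} {w} (xs : List A) → ¬ CloseRepeat w xs → Fresh w xs
¬closeRepeat⇒fresh [] _ = []
¬closeRepeat⇒fresh {w = w} (a ∷ xs) noRepeat = a∉ ∷ ¬closeRepeat⇒fresh xs noRepeatTail
  where
  a∉ : ¬ a ∈ take w xs
  a∉ a∈ with m , v , refl , m<w ← ∈-take-split w xs a∈ = noRepeat ([] , a , m , v , refl , m<w)
  noRepeatTail : ¬ CloseRepeat w xs
  noRepeatTail (u , b , m , v , refl , m<w) = noRepeat (a ∷ u , b , m , v , refl , m<w)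

reverse-around : ∀ {A : Set} (u : List A) a t → reverse (u ++ a ∷ t) ≡ reverse t ++ a ∷ reverse u
reverse-around u a t = begin
    reverse (u ++ a ∷ t)
  ≡⟨ reverse-++ u (a ∷ t) ⟩
    reverse (a ∷ t) ++ reverse u
  ≡⟨ cong (_++ reverse u) (unfold-reverse a t) ⟩
    (reverse t ++ [ a ]) ++ reverse u
  ≡⟨ ++-assoc (reverse t) [ a ] (reverse u) ⟩
    reverse t ++ a ∷ reverse u ∎
  where open ≡-Reasoning

closeRepeat-reverse : ∀ {A : Set} {w} (xs : List A) → CloseRepeat w (reverse xs) → CloseRepeat w xs
closeRepeat-reverse xs (u , a , m , v , eq , m<w) =
  reverse v , a , reverse m , reverse u , reversed , subst (_< _) (sym (length-reverse m)) m<w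
  where
  open ≡-Reasoning
  reversed : xs ≡ reverse v ++ a ∷ reverse m ++ a ∷ reverse u
  reversed = begin
      xs
    ≡⟨ sym (reverse-involutive xs) ⟩
      reverse (reverse xs)
    ≡⟨ cong reverse eq ⟩
      reverse (u ++ a ∷ m ++ a ∷ v)
    ≡⟨ reverse-around u a (m ++ a ∷ v) ⟩
      reverse (m ++ a ∷ v) ++ a ∷ reverse u
    ≡⟨ cong (_++ a ∷ reverse u) (reverse-around m a v) ⟩
      (reverse v ++ a ∷ reverse m) ++ a ∷ reverse u
    ≡⟨ ++-assoc (reverse v) (a ∷ reverse m) (a ∷ reverse u) ⟩
      reverse v ++ a ∷ reverse m ++ a ∷ reverse u ∎

fresh-reverse : ∀ {A : Set} {w} {xs : List A} → Fresh w xs → Fresh w (reverse xs)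
fresh-reverse {xs = xs} fresh = ¬closeRepeat⇒fresh (reverse xs) (fresh⇒¬closeRepeat fresh ∘ closeRepeat-reverse xs)

module _ {n : ℕ} where

  lookup-∈-take : ∀ (xs : List (Fin n)) (j : Fin (length xs)) w → toℕ j < w → lookup xs j ∈ take w xs
  lookup-∈-take (x ∷ xs) fzero (suc w) _ = here refl
  lookup-∈-take (x ∷ xs) (fsuc j) (suc w) (s≤s j<w) = there (lookup-∈-take xs j w j<w)

  ∈-take-lookup : ∀ {a} (xs : List (Fin n)) w → a ∈ take w xs →
    ∃ λ (j : Fin (length xs)) → toℕ j < w × lookup xs j ≡ a
  ∈-take-lookup (x ∷ xs) (suc w) (here refl) = fzero , s≤s z≤n , refl
  ∈-take-lookup (x ∷ xs) (suc w) (there a∈) with j , j<w , eq ← ∈-take-lookup xs w a∈ = fsuc j , s≤s j<w , eq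

  sparse⇒fresh : ∀ w (xs : List (Fin n)) → Sparse (suc w) xs → Fresh w xs
  sparse⇒fresh w [] _ = []
  sparse⇒fresh w (a ∷ xs) sparse = a∉ ∷ sparse⇒fresh w xs (λ i j i<j eq → sparse (fsuc i) (fsuc j) (s≤s i<j) eq)
    where
    a∉ : ¬ a ∈ take w xs
    a∉ a∈ with j , j<w , eq ← ∈-take-lookup xs w a∈ = <⇒≱ j<w (≤-pred (sparse fzero (fsuc j) (s≤s z≤n) (sym eq)))

  fresh⇒sparse : ∀ w (xs : List (Fin n)) → Fresh w xs → Sparse (suc w) xs
  fresh⇒sparse w (a ∷ xs) (a∉ ∷ fresh) fzero (fsuc j) _ eq with toℕ j <? w
  ... | yes j<w = ⊥-elim (a∉ (subst (_∈ take w xs) (sym eq) (lookup-∈-take xs j w j<w)))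
  ... | no j≮w = s≤s (≮⇒≥ j≮w)
  fresh⇒sparse w (a ∷ xs) (_ ∷ fresh) (fsuc i) (fsuc j) (s≤s i<j) eq = fresh⇒sparse w xs fresh i j i<j eq

data Mark : Set where
  kept skipped blocked : Mark

Marking : ℕ → Set
Marking n = List (Fin n × Mark)

module _ {n : ℕ} where

  letters : Marking n → List (Fin n)
  letters = map proj₁

  keptLetters : Marking n → List (Fin n)
  keptLetters [] = []
  keptLetters ((a , kept) ∷ M) = a ∷ keptLetters M
  keptLetters ((a , skipped) ∷ M) = keptLetters M
  keptLetters ((a , blocked) ∷ M) = keptLetters M

  unblockedLetters : Marking n → List (Fin n)
  unblockedLetters [] = []
  unblockedLetters ((a , blocked) ∷ M) = unblockedLetters M
  unblockedLetters ((a , _) ∷ M) = a ∷ unblockedLetters M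

  marksOf : Fin n → Marking n → List Mark
  marksOf y [] = []
  marksOf y ((a , m) ∷ M) with y ≟ a
  ... | yes _ = m ∷ marksOf y M
  ... | no _ = marksOf y M

  marksOf-++ : ∀ y (M₁ M₂ : Marking n) → marksOf y (M₁ ++ M₂) ≡ marksOf y M₁ ++ marksOf y M₂
  marksOf-++ y [] M₂ = refl
  marksOf-++ y ((a , m) ∷ M₁) M₂ with y ≟ a
  ... | yes _ = cong (m ∷_) (marksOf-++ y M₁ M₂)
  ... | no _ = marksOf-++ y M₁ M₂

  length-marksOf : ∀ y (M : Marking n) → length (marksOf y M) ≡ occ y (letters M)
  length-marksOf y [] = refl
  length-marksOf y ((a , m) ∷ M) with y ≟ a
  ... | yes _ = cong suc (length-marksOf y M)
  ... | no _ = length-marksOf y M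

#kept : List Mark → ℕ
#kept [] = 0
#kept (kept ∷ ms) = suc (#kept ms)
#kept (skipped ∷ ms) = #kept ms
#kept (blocked ∷ ms) = #kept ms

#unblocked : List Mark → ℕ
#unblocked [] = 0
#unblocked (kept ∷ ms) = suc (#unblocked ms)
#unblocked (skipped ∷ ms) = suc (#unblocked ms)
#unblocked (blocked ∷ ms) = #unblocked ms

#blocked : List Mark → ℕ
#blocked [] = 0
#blocked (kept ∷ ms) = #blocked ms
#blocked (skipped ∷ ms) = #blocked ms
#blocked (blocked ∷ ms) = suc (#blocked ms)

length-marks : ∀ ms → length ms ≡ #unblocked ms + #blocked ms
length-marks [] = refl
length-marks (kept ∷ ms) = cong suc (length-marks ms)
length-marks (skipped ∷ ms) = cong suc (length-marks ms)
length-marks (blocked ∷ ms) = trans (cong suc (length-marks ms)) (sym (+-suc _ _))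

module _ {n : ℕ} where

  #kept-marksOf : ∀ y (M : Marking n) → #kept (marksOf y M) ≡ occ y (keptLetters M)
  #kept-marksOf y [] = refl
  #kept-marksOf y ((a , kept) ∷ M) with y ≟ a
  ... | yes _ = cong suc (#kept-marksOf y M)
  ... | no _ = #kept-marksOf y M
  #kept-marksOf y ((a , skipped) ∷ M) with y ≟ a
  ... | yes _ = #kept-marksOf y M
  ... | no _ = #kept-marksOf y M
  #kept-marksOf y ((a , blocked) ∷ M) with y ≟ a
  ... | yes _ = #kept-marksOf y M
  ... | no _ = #kept-marksOf y M

  #unblocked-marksOf : ∀ y (M : Marking n) → #unblocked (marksOf y M) ≡ occ y (unblockedLetters M)
  #unblocked-marksOf y [] = refl
  #unblocked-marksOf y ((a , kept) ∷ M) with y ≟ a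
  ... | yes _ = cong suc (#unblocked-marksOf y M)
  ... | no _ = #unblocked-marksOf y M
  #unblocked-marksOf y ((a , skipped) ∷ M) with y ≟ a
  ... | yes _ = cong suc (#unblocked-marksOf y M)
  ... | no _ = #unblocked-marksOf y M
  #unblocked-marksOf y ((a , blocked) ∷ M) with y ≟ a
  ... | yes _ = #unblocked-marksOf y M
  ... | no _ = #unblocked-marksOf y M

  length-unblockedLetters : ∀ (M : Marking n) → length (unblockedLetters M) ≡ #unblocked (map proj₂ M)
  length-unblockedLetters [] = refl
  length-unblockedLetters ((a , kept) ∷ M) = cong suc (length-unblockedLetters M)
  length-unblockedLetters ((a , skipped) ∷ M) = cong suc (length-unblockedLetters M)
  length-unblockedLetters ((a , blocked) ∷ M) = length-unblockedLetters M

  keptLetters-⊆ : ∀ (M : Marking n) → keptLetters M ⊆ letters M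
  keptLetters-⊆ [] = []
  keptLetters-⊆ ((a , kept) ∷ M) = refl ∷ keptLetters-⊆ M
  keptLetters-⊆ ((a , skipped) ∷ M) = a ∷ʳ keptLetters-⊆ M
  keptLetters-⊆ ((a , blocked) ∷ M) = a ∷ʳ keptLetters-⊆ M

  keptLetters-split : ∀ (xs ys : List (Fin n)) M → xs ++ ys ⊆ keptLetters M →
    ∃₂ λ M₁ M₂ → M ≡ M₁ ++ M₂ × xs ⊆ keptLetters M₁ × ys ⊆ keptLetters M₂
  keptLetters-split [] ys M ys⊆ = [] , M , refl , [] , ys⊆
  keptLetters-split (x ∷ xs) ys ((a , kept) ∷ M) (.a ∷ʳ x∷xs⊆)
    with M₁ , M₂ , refl , xs⊆ , ys⊆ ← keptLetters-split (x ∷ xs) ys M x∷xs⊆ =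
      (a , kept) ∷ M₁ , M₂ , refl , a ∷ʳ xs⊆ , ys⊆
  keptLetters-split (x ∷ xs) ys ((a , kept) ∷ M) (x≡a ∷ xs⊆′)
    with M₁ , M₂ , refl , xs⊆ , ys⊆ ← keptLetters-split xs ys M xs⊆′ =
      (a , kept) ∷ M₁ , M₂ , refl , x≡a ∷ xs⊆ , ys⊆
  keptLetters-split (x ∷ xs) ys ((a , skipped) ∷ M) x∷xs⊆
    with M₁ , M₂ , refl , xs⊆ , ys⊆ ← keptLetters-split (x ∷ xs) ys M x∷xs⊆ =
      (a , skipped) ∷ M₁ , M₂ , refl , xs⊆ , ys⊆
  keptLetters-split (x ∷ xs) ys ((a , blocked) ∷ M) x∷xs⊆
    with M₁ , M₂ , refl , xs⊆ , ys⊆ ← keptLetters-split (x ∷ xs) ys M x∷xs⊆ =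
      (a , blocked) ∷ M₁ , M₂ , refl , xs⊆ , ys⊆

-- Trace k c ms : ms are the marks of the successive occurrences of one letter, and c occurrences
-- of it precede ms since its last kept occurrence (or since the start).
data Trace (k : ℕ) : ℕ → List Mark → Set where
  []      : ∀ {c} → Trace k c []
  keep    : ∀ {c ms} → k ≤ c → k ≤ length ms → Trace k 0 ms → Trace k c (kept ∷ ms)
  tooSoon : ∀ {c ms} → c < k → Trace k (suc c) ms → Trace k c (skipped ∷ ms)
  tooLate : ∀ {c ms} → length ms < k → Trace k (suc c) ms → Trace k c (skipped ∷ ms)
  block   : ∀ {c ms} → Trace k (suc c) ms → Trace k c (blocked ∷ ms)

module _ {k : ℕ} where

  trace-suffix : ∀ {c} p {q} → Trace k c (p ++ q) → ∃ λ c′ → Trace k c′ q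
  trace-suffix [] t = _ , t
  trace-suffix (kept ∷ p) (keep _ _ t) = trace-suffix p t
  trace-suffix (skipped ∷ p) (tooSoon _ t) = trace-suffix p t
  trace-suffix (skipped ∷ p) (tooLate _ t) = trace-suffix p t
  trace-suffix (blocked ∷ p) (block t) = trace-suffix p t

  trace-first : ∀ {c} p {q} → Trace k c (p ++ q) → 1 ≤ #kept p → suc k ≤ length p + c
  trace-first (kept ∷ p) (keep k≤c _ _) _ = s≤s (≤-trans k≤c (m≤n+m _ (length p)))
  trace-first (skipped ∷ p) (tooSoon _ t) kept∈p = ≤-trans (trace-first p t kept∈p) (≤-reflexive (+-suc (length p) _))
  trace-first (skipped ∷ p) (tooLate _ t) kept∈p = ≤-trans (trace-first p t kept∈p) (≤-reflexive (+-suc (length p) _))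
  trace-first (blocked ∷ p) (block t) kept∈p = ≤-trans (trace-first p t kept∈p) (≤-reflexive (+-suc (length p) _))

  trace-second : ∀ {c} p {q} → Trace k c (p ++ q) → 2 ≤ #kept p → suc (suc k) ≤ length p
  trace-second (kept ∷ p) (keep _ _ t) (s≤s kept∈p) =
    s≤s (≤-trans (trace-first p t kept∈p) (≤-reflexive (+-identityʳ _)))
  trace-second (skipped ∷ p) (tooSoon _ t) twice = m≤n⇒m≤1+n (trace-second p t twice)
  trace-second (skipped ∷ p) (tooLate _ t) twice = m≤n⇒m≤1+n (trace-second p t twice)
  trace-second (blocked ∷ p) (block t) twice = m≤n⇒m≤1+n (trace-second p t twice)

  trace-last : ∀ {c} p → Trace k c p → 1 ≤ #kept p → suc k ≤ length p
  trace-last (kept ∷ p) (keep _ k≤rest _) _ = s≤s k≤rest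
  trace-last (skipped ∷ p) (tooSoon _ t) kept∈p = m≤n⇒m≤1+n (trace-last p t kept∈p)
  trace-last (skipped ∷ p) (tooLate _ t) kept∈p = m≤n⇒m≤1+n (trace-last p t kept∈p)
  trace-last (blocked ∷ p) (block t) kept∈p = m≤n⇒m≤1+n (trace-last p t kept∈p)

  -- Each kept occurrence pays for at most k+1 unblocked ones; the rest is at most 2k.
  trace-count : ∀ {c} ms → Trace k c ms → #unblocked ms ≤ suc k * #kept ms + (k ∸ c) + k
  trace-count [] [] = z≤n
  trace-count {c} (kept ∷ ms) (keep _ _ t) = begin
      suc (#unblocked ms)
    ≤⟨ s≤s (trace-count ms t) ⟩
      suc (suc k * #kept ms + k + k)
    ≤⟨ +-monoˡ-≤ k (≤-trans (≤-reflexive (cong suc (+-comm (suc k * #kept ms) k))) (m≤m+n _ (k ∸ c))) ⟩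
      suc k + suc k * #kept ms + (k ∸ c) + k
    ≡⟨ cong (λ t → t + (k ∸ c) + k) (sym (*-suc (suc k) (#kept ms))) ⟩
      suc k * suc (#kept ms) + (k ∸ c) + k ∎
    where open ≤-Reasoning
  trace-count {c} (skipped ∷ ms) (tooSoon c<k t) = begin
      suc (#unblocked ms)
    ≤⟨ s≤s (trace-count ms t) ⟩
      suc (suc k * #kept ms + (k ∸ suc c) + k)
    ≡⟨ cong (_+ k) (sym (+-suc (suc k * #kept ms) (k ∸ suc c))) ⟩
      suc k * #kept ms + suc (k ∸ suc c) + k
    ≡⟨ cong (λ t → suc k * #kept ms + t + k) (sym (+-∸-assoc 1 c<k)) ⟩
      suc k * #kept ms + (k ∸ c) + k ∎
    where open ≤-Reasoning
  trace-count (skipped ∷ ms) (tooLate late _) =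
    ≤-trans (s≤s (≤-trans (m≤m+n _ (#blocked ms)) (≤-reflexive (sym (length-marks ms))))) (≤-trans late (m≤n+m k _))
  trace-count (blocked ∷ ms) (block t) = ≤-trans (trace-count ms t)
    (+-monoˡ-≤ k (+-monoʳ-≤ _ (∸-monoʳ-≤ k (n≤1+n _))))

Traced : ∀ {n} → ℕ → Marking n → Set
Traced k M = ∀ y → ∃ λ c → Trace k c (marksOf y M)

module _ {n k : ℕ} where

  traced-suffix : ∀ (M₁ M₂ : Marking n) → Traced k (M₁ ++ M₂) → Traced k M₂
  traced-suffix M₁ M₂ traced y with c , t ← traced y =
    trace-suffix (marksOf y M₁) (subst (Trace k c) (marksOf-++ y M₁ M₂) t)

  often-initial : ∀ y (M₁ M₂ : Marking n) → Trace k 0 (marksOf y (M₁ ++ M₂)) →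
    1 ≤ occ y (keptLetters M₁) → suc k ≤ occ y (letters M₁)
  often-initial y M₁ M₂ t kept≥1 = subst (suc k ≤_) (trans (+-identityʳ _) (length-marksOf y M₁))
    (trace-first (marksOf y M₁) (subst (Trace k 0) (marksOf-++ y M₁ M₂) t)
      (subst (1 ≤_) (sym (#kept-marksOf y M₁)) kept≥1))

  often-twice : ∀ y (M₁ M₂ : Marking n) → ∃ (λ c → Trace k c (marksOf y (M₁ ++ M₂))) →
    2 ≤ occ y (keptLetters M₁) → suc (suc k) ≤ occ y (letters M₁)
  often-twice y M₁ M₂ (c , t) kept≥2 = subst (suc (suc k) ≤_) (length-marksOf y M₁)
    (trace-second (marksOf y M₁) (subst (Trace k c) (marksOf-++ y M₁ M₂) t)
      (subst (2 ≤_) (sym (#kept-marksOf y M₁)) kept≥2))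

  often-final : ∀ y (M : Marking n) → ∃ (λ c → Trace k c (marksOf y M)) →
    1 ≤ occ y (keptLetters M) → suc k ≤ occ y (letters M)
  often-final y M (c , t) kept≥1 = subst (suc k ≤_) (length-marksOf y M)
    (trace-last (marksOf y M) t (subst (1 ≤_) (sym (#kept-marksOf y M)) kept≥1))

module Lifting {k n : ℕ} (f : Fin (suc k) → Fin n) (f-inj : Injective _≡_ _≡_ f) where

  open Extraction f f-inj

  kept-often : ∀ {σ} (M : Marking n) x → map f σ ⊆ keptLetters M → occ x σ ≤ occ (f x) (keptLetters M)
  kept-often {σ} M x σ⊆ = subst (_≤ _) (occ-map f f-inj x σ) (occ-⊆ (f x) σ⊆)

  initialBlock : ∀ {σ} (M₁ M₂ : Marking n) → IsPerm σ → map f σ ⊆ keptLetters M₁ →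
    (∀ y → Trace k 0 (marksOf y (M₁ ++ M₂))) →
    ∃₂ λ x π → IsPerm (x ∷ π) × map f (x ∷ double π) ⊆ letters M₁
  initialBlock M₁ M₂ perm σ⊆ spaced =
    leadingDoubled k (allFin (suc k)) (letters M₁) (length-allFin (suc k)) (allFin⁺ (suc k)) λ x _ →
      often-initial (f x) M₁ M₂ (spaced (f x)) (≤-trans (≤-reflexive (sym (occ-perm perm x))) (kept-often M₁ x σ⊆))

  middleBlocks : ∀ (mids : List (List (Fin (suc k)))) (M T : Marking n) → All IsTwice mids →
    map f (concat mids) ⊆ keptLetters M → Traced k (M ++ T) →
    ∃ λ πs → All IsPerm πs × length πs ≡ length mids × map f (double (concat πs)) ⊆ letters M
  middleBlocks [] M T [] _ _ = [] , [] , refl , minimum _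
  middleBlocks (μ ∷ mids) M T (twice ∷ twices) μs⊆ traced
    with M₁ , M₂ , refl , μ⊆ , mids⊆ ←
           keptLetters-split (map f μ) (map f (concat mids)) M (subst (_⊆ keptLetters M) (map-++ f μ (concat mids)) μs⊆)
    = let π , π↭ , π⊆ =
            doubledPermutation (suc k) (allFin (suc k)) (letters M₁) (length-allFin (suc k)) (allFin⁺ (suc k)) often
          πs , perms , length-πs , πs⊆ = middleBlocks mids M₂ T twices mids⊆ (traced-suffix M₁ (M₂ ++ T) traced′)
      in π ∷ πs , π↭ ∷ perms , cong suc length-πs ,
         subst₂ _⊆_ (sym (doubled π πs)) (sym (map-++ proj₁ M₁ M₂)) (SubP.++⁺ π⊆ πs⊆)
    where
    traced′ : Traced k (M₁ ++ (M₂ ++ T))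
    traced′ = subst (Traced k) (++-assoc M₁ M₂ T) traced
    often : ∀ x → x ∈ allFin (suc k) → suc (suc k) ≤ occ (f x) (letters M₁)
    often x _ = often-twice (f x) M₁ (M₂ ++ T) (traced′ (f x))
      (≤-trans (≤-reflexive (sym (occ-twice twice x))) (kept-often M₁ x μ⊆))
    doubled : ∀ π πs → map f (double (concat (π ∷ πs))) ≡ map f (double π) ++ map f (double (concat πs))
    doubled π πs = trans (cong (map f) (double-++ π (concat πs))) (map-++ f (double π) _)

  finalBlock : ∀ {σ} (M : Marking n) → IsPerm σ → map f σ ⊆ keptLetters M → Traced k M →
    ∃₂ λ π x → IsPerm (π ++ [ x ]) × map f (double π ++ [ x ]) ⊆ letters M
  finalBlock M perm σ⊆ traced =
    trailingDoubled k (allFin (suc k)) (letters M) (length-allFin (suc k)) (allFin⁺ (suc k)) λ x _ →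
      often-final (f x) M (traced (f x)) (≤-trans (≤-reflexive (sym (occ-perm perm x))) (kept-often M x σ⊆))

  liftPattern : ∀ s → 1 ≤ s → (M : Marking n) → (∀ y → Trace k 0 (marksOf y M)) →
    ∀ {τ} → PermDbl (suc k) s τ → map f τ ⊆ keptLetters M →
    ∃ λ σ → Perm (suc k) (suc s) σ × map f (dbl σ) ⊆ letters M
  liftPattern s s≥1 M spaced (σ₁ , mids , σₗ , perm₁ , permₗ , length-mids , twices , refl) τ⊆
    with M₁ , M′ , refl , σ₁⊆ , rest⊆ ←
           keptLetters-split (map f σ₁) (map f (concat mids) ++ map f σₗ) M
             (subst (_⊆ keptLetters M) (map-++₃ f σ₁ (concat mids) σₗ) τ⊆)
    with Mₘ , Mₗ , refl , mids⊆ , σₗ⊆ ← keptLetters-split (map f (concat mids)) (map f σₗ) M′ rest⊆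
    = let x , π₁ , p₁ , π₁⊆ = initialBlock M₁ (Mₘ ++ Mₗ) perm₁ σ₁⊆ spaced
          πs , ps , length-πs , πs⊆ = middleBlocks mids Mₘ Mₗ twices mids⊆ tracedₘ
          πₗ , y , pₗ , πₗ⊆ = finalBlock Mₗ permₗ σₗ⊆ (traced-suffix Mₘ Mₗ tracedₘ)
      in (x ∷ π₁) ++ concat πs ++ (πₗ ++ [ y ]) ,
         perm-blocks s s≥1 (x ∷ π₁) πs (πₗ ++ [ y ]) p₁ ps pₗ (trans length-πs length-mids) ,
         subst₂ _⊆_ (sym (embedded x π₁ πs πₗ y)) (sym (map-++₃ proj₁ M₁ Mₘ Mₗ))
           (SubP.++⁺ π₁⊆ (SubP.++⁺ πs⊆ πₗ⊆))
    where
    tracedₘ : Traced k (Mₘ ++ Mₗ)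
    tracedₘ = traced-suffix M₁ (Mₘ ++ Mₗ) (λ y → 0 , spaced y)
    embedded : ∀ x π₁ πs πₗ y → map f (dbl ((x ∷ π₁) ++ concat πs ++ (πₗ ++ [ y ]))) ≡
      map f (x ∷ double π₁) ++ map f (double (concat πs)) ++ map f (double πₗ ++ [ y ])
    embedded x π₁ πs πₗ y =
      trans (cong (map f) (dbl-blocks x π₁ (concat πs) πₗ y)) (map-++₃ f (x ∷ double π₁) (double (concat πs)) _)

kept-free : ∀ {k n} s → 1 ≤ s → (M : Marking n) → (∀ y → Trace k 0 (marksOf y M)) →
  Free (DblPerm (suc k) (suc s)) (letters M) → Free (PermDbl (suc k) s) (keptLetters M)
kept-free s s≥1 M spaced free τ τ∈PermDbl (f , f-inj , τ⊆)
  with σ , σ∈Perm , dblσ⊆ ← Lifting.liftPattern f f-inj s s≥1 M spaced τ∈PermDbl τ⊆ =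
  free (dbl σ) (σ , σ∈Perm , refl) (f , f-inj , dblσ⊆)

-- It scans S from left to right; c y counts the
-- occurrences of y since its last kept occurrence and H lists the kept letters, most recent first.
data Decision {n} (k b : ℕ) (c : Fin n → ℕ) (H : List (Fin n)) (a : Fin n) (S : List (Fin n)) : Set where
  keep    : k ≤ c a → k ≤ occ a S → ¬ a ∈ take b H → Decision k b c H a S
  block   : a ∈ take b H → Decision k b c H a S
  tooSoon : c a < k → Decision k b c H a S
  tooLate : occ a S < k → Decision k b c H a S

decide : ∀ {n} k b c H (a : Fin n) S → Decision k b c H a S
decide k b c H a S with k ≤? c a | k ≤? occ a S | any? (a ≟_) (take b H)
... | no soon | _ | _ = tooSoon (≰⇒> soon)
... | yes _ | no late | _ = tooLate (≰⇒> late)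
... | yes _ | yes _ | yes recent = block recent
... | yes behind | yes ahead | no notRecent = keep behind ahead notRecent

reset bump : ∀ {n} → (Fin n → ℕ) → Fin n → Fin n → ℕ
reset c a = updateAt c a (λ _ → 0)
bump c a = updateAt c a suc

greedy : ∀ {n} (k b : ℕ) → (Fin n → ℕ) → List (Fin n) → List (Fin n) → Marking n
greedy k b c H [] = []
greedy k b c H (a ∷ S) with decide k b c H a S
... | keep _ _ _ = (a , kept) ∷ greedy k b (reset c a) (a ∷ H) S
... | block _ = (a , blocked) ∷ greedy k b (bump c a) H S
... | tooSoon _ = (a , skipped) ∷ greedy k b (bump c a) H S
... | tooLate _ = (a , skipped) ∷ greedy k b (bump c a) H S

module _ {n : ℕ} (k b : ℕ) where

  letters-greedy : ∀ c H (S : List (Fin n)) → letters (greedy k b c H S) ≡ S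
  letters-greedy c H [] = refl
  letters-greedy c H (a ∷ S) with decide k b c H a S
  ... | keep _ _ _ = cong (a ∷_) (letters-greedy (reset c a) (a ∷ H) S)
  ... | block _ = cong (a ∷_) (letters-greedy (bump c a) H S)
  ... | tooSoon _ = cong (a ∷_) (letters-greedy (bump c a) H S)
  ... | tooLate _ = cong (a ∷_) (letters-greedy (bump c a) H S)

  length-marksOf-greedy : ∀ c H (S : List (Fin n)) y → length (marksOf y (greedy k b c H S)) ≡ occ y S
  length-marksOf-greedy c H S y = trans (length-marksOf y (greedy k b c H S)) (cong (occ y) (letters-greedy c H S))

  trace-cons : ∀ (c : Fin n → ℕ) a m (g : ℕ → ℕ) M →
    (Trace k (g (c a)) (marksOf a M) → Trace k (c a) (m ∷ marksOf a M)) →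
    (∀ y → Trace k (updateAt c a g y) (marksOf y M)) → ∀ y → Trace k (c y) (marksOf y ((a , m) ∷ M))
  trace-cons c a m g M step traces y with y ≟ a
  ... | yes refl = step (subst (λ t → Trace k t (marksOf a M)) (updateAt-updates a c) (traces a))
  ... | no y≢a = subst (λ t → Trace k t (marksOf y M)) (updateAt-minimal y a c y≢a) (traces y)

  greedy-trace : ∀ c H (S : List (Fin n)) y → Trace k (c y) (marksOf y (greedy k b c H S))
  greedy-trace c H [] y = []
  greedy-trace c H (a ∷ S) with decide k b c H a S
  ... | keep behind ahead _ = trace-cons c a kept (λ _ → 0) _
        (keep behind (subst (k ≤_) (sym (length-marksOf-greedy (reset c a) (a ∷ H) S a)) ahead))
        (greedy-trace (reset c a) (a ∷ H) S)
  ... | block _ = trace-cons c a blocked suc _ block (greedy-trace (bump c a) H S)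
  ... | tooSoon soon = trace-cons c a skipped suc _ (tooSoon soon) (greedy-trace (bump c a) H S)
  ... | tooLate late = trace-cons c a skipped suc _
        (tooLate (subst (_< k) (sym (length-marksOf-greedy (bump c a) H S a)) late)) (greedy-trace (bump c a) H S)

  greedy-fresh : ∀ c H (S : List (Fin n)) → Fresh b H → Fresh b (keptLetters (greedy k b c H S) ʳ++ H)
  greedy-fresh c H [] fresh = fresh
  greedy-fresh c H (a ∷ S) fresh with decide k b c H a S
  ... | keep _ _ notRecent = greedy-fresh (reset c a) (a ∷ H) S (notRecent ∷ fresh)
  ... | block _ = greedy-fresh (bump c a) H S fresh
  ... | tooSoon _ = greedy-fresh (bump c a) H S fresh
  ... | tooLate _ = greedy-fresh (bump c a) H S fresh

-- Runs b z ms : every maximal run of blocked marks in ms has length at most b; the run at the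
-- front of ms continues z blocked marks preceding it.
data Runs (b : ℕ) : ℕ → List Mark → Set where
  []          : ∀ {z} → Runs b z []
  run-kept    : ∀ {z ms} → Runs b 0 ms → Runs b z (kept ∷ ms)
  run-skipped : ∀ {z ms} → Runs b 0 ms → Runs b z (skipped ∷ ms)
  run-blocked : ∀ {z ms} → suc z ≤ b → Runs b (suc z) ms → Runs b z (blocked ∷ ms)

run-ends : ∀ {b z} ms → z ≤ b → #blocked ms + 0 ≤ b * #unblocked ms + b → #blocked ms + z ≤ b * suc (#unblocked ms) + b
run-ends {b} {z} ms z≤b bound = begin
    #blocked ms + z
  ≤⟨ +-mono-≤ (≤-trans (m≤m+n (#blocked ms) 0) bound) z≤b ⟩
    b * #unblocked ms + b + b
  ≡⟨ cong (_+ b) (+-comm (b * #unblocked ms) b) ⟩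
    b + b * #unblocked ms + b
  ≡⟨ cong (_+ b) (sym (*-suc b (#unblocked ms))) ⟩
    b * suc (#unblocked ms) + b ∎
  where open ≤-Reasoning

runs-count : ∀ {b z} ms → z ≤ b → Runs b z ms → #blocked ms + z ≤ b * #unblocked ms + b
runs-count [] z≤b [] = ≤-trans z≤b (m≤n+m _ _)
runs-count (kept ∷ ms) z≤b (run-kept runs) = run-ends ms z≤b (runs-count ms z≤n runs)
runs-count (skipped ∷ ms) z≤b (run-skipped runs) = run-ends ms z≤b (runs-count ms z≤n runs)
runs-count (blocked ∷ ms) z≤b (run-blocked z<b runs) = ≤-trans (≤-reflexive (sym (+-suc _ _))) (runs-count ms z<b runs)

few-blocked : ∀ {n} b (M : Marking n) → Runs b 0 (map proj₂ M) →
  length (letters M) ≤ suc b * length (unblockedLetters M) + b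
few-blocked b M runs = begin
    length (letters M)
  ≡⟨ trans (length-map proj₁ M) (sym (length-map proj₂ M)) ⟩
    length ms
  ≡⟨ length-marks ms ⟩
    #unblocked ms + #blocked ms
  ≤⟨ +-monoʳ-≤ (#unblocked ms) (≤-trans (m≤m+n _ 0) (runs-count ms z≤n runs)) ⟩
    #unblocked ms + (b * #unblocked ms + b)
  ≡⟨ sym (+-assoc (#unblocked ms) _ b) ⟩
    suc b * #unblocked ms + b
  ≡⟨ cong (λ t → suc b * t + b) (length-unblockedLetters M) ⟨
    suc b * length (unblockedLetters M) + b ∎
  where
  open ≤-Reasoning
  ms = map proj₂ M

module _ {n : ℕ} (k b : ℕ) where

  -- If S is b-fresh, runs of blocked letters in the greedy marking have length at most b: the
  -- letters of a run are distinct (by freshness of S) and all among the b most recently kept ones.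
  -- P is the part of S already scanned, most recent first; the current run is take z P.
  greedy-runs : ∀ c H P (S : List (Fin n)) z → Fresh b (S ʳ++ P) → z ≤ b → z ≤ length P →
    Unique (take z P) → (∀ {x} → x ∈ take z P → x ∈ take b H) → Runs b z (map proj₂ (greedy k b c H S))
  greedy-runs c H P [] z _ _ _ _ _ = []
  greedy-runs c H P (a ∷ S) z fresh z≤b z≤P distinct recentRun with decide k b c H a S
  ... | keep _ _ _ = run-kept (greedy-runs (reset c a) (a ∷ H) (a ∷ P) S 0 fresh z≤n z≤n [] λ ())
  ... | tooSoon _ = run-skipped (greedy-runs (bump c a) H (a ∷ P) S 0 fresh z≤n z≤n [] λ ())
  ... | tooLate _ = run-skipped (greedy-runs (bump c a) H (a ∷ P) S 0 fresh z≤n z≤n [] λ ())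
  ... | block recent =
    run-blocked run<b (greedy-runs (bump c a) H (a ∷ P) S (suc z) fresh run<b (s≤s z≤P) distinct′ recentRun′)
    where
    a∉P : ¬ a ∈ take b P
    a∉P with a∉ ∷ _ ← fresh-suffix S fresh = a∉
    distinct′ : Unique (a ∷ take z P)
    distinct′ = ¬Any⇒All¬ _ (a∉P ∘ SubP.Any-resp-⊆ (SubP.take⁺ z≤b)) ∷ distinct
    recentRun′ : ∀ {x} → x ∈ a ∷ take z P → x ∈ take b H
    recentRun′ (here refl) = recent
    recentRun′ (there x∈run) = recentRun x∈run
    run<b : suc z ≤ b
    run<b = begin
        suc z
      ≡⟨ cong suc (trans (length-take z P) (m≤n⇒m⊓n≡m z≤P)) ⟨
        length (a ∷ take z P)
      ≤⟨ pigeonhole distinct′ recentRun′ ⟩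
        length (take b H)
      ≤⟨ ≤-trans (≤-reflexive (length-take b H)) (m⊓n≤m b (length H)) ⟩
        b ∎
      where open ≤-Reasoning

unblocked-bound : ∀ {n} k (M : Marking n) → (∀ y → Trace k 0 (marksOf y M)) →
  length (unblockedLetters M) ≤ suc k * length (keptLetters M) + n * (k + k)
unblocked-bound {n} k M spaced = begin
    length (unblockedLetters M)
  ≡⟨ ∑-occ (unblockedLetters M) ⟨
    ∑ n (λ y → occ y (unblockedLetters M))
  ≤⟨ ∑-mono n per-letter ⟩
    ∑ n (λ y → suc k * occ y (keptLetters M) + (k + k))
  ≡⟨ ∑-+ n _ _ ⟩
    ∑ n (λ y → suc k * occ y (keptLetters M)) + ∑ n (λ _ → k + k)
  ≡⟨ cong₂ _+_ (trans (∑-*ˡ n (suc k) _) (cong (suc k *_) (∑-occ (keptLetters M)))) (∑-const n (k + k)) ⟩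
    suc k * length (keptLetters M) + n * (k + k) ∎
  where
  open ≤-Reasoning
  per-letter : ∀ y → occ y (unblockedLetters M) ≤ suc k * occ y (keptLetters M) + (k + k)
  per-letter y = subst₂ _≤_ (#unblocked-marksOf y M)
    (trans (cong (λ t → suc k * t + k + k) (#kept-marksOf y M)) (+-assoc _ k k))
    (trace-count (marksOf y M) (spaced y))

module _ {A : Set} where

  ⊆-++-split : ∀ {xs : List A} ys zs → xs ⊆ ys ++ zs → ∃₂ λ u v → xs ≡ u ++ v × u ⊆ ys × v ⊆ zs
  ⊆-++-split [] zs xs⊆ = [] , _ , refl , [] , xs⊆
  ⊆-++-split (y ∷ ys) zs (.y ∷ʳ xs⊆) with u , v , refl , u⊆ , v⊆ ← ⊆-++-split ys zs xs⊆ =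
    u , v , refl , y ∷ʳ u⊆ , v⊆
  ⊆-++-split (y ∷ ys) zs (refl ∷ xs⊆) with u , v , refl , u⊆ , v⊆ ← ⊆-++-split ys zs xs⊆ =
    y ∷ u , v , refl , refl ∷ u⊆ , v⊆

  unique-⊆ : ∀ {xs ys : List A} → xs ⊆ ys → Unique ys → Unique xs
  unique-⊆ [] _ = []
  unique-⊆ (y ∷ʳ xs⊆) (_ ∷ u) = unique-⊆ xs⊆ u
  unique-⊆ (refl ∷ xs⊆) (y∉ ∷ u) = SubP.All-resp-⊆ xs⊆ y∉ ∷ unique-⊆ xs⊆ u

  blocks-⊆ : ∀ (L : List (List A)) {xs} → xs ⊆ concat L → All Unique L →
    ∃ λ L′ → length L′ ≡ length L × All Unique L′ × concat L′ ≡ xs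
  blocks-⊆ [] [] _ = [] , refl , [] , refl
  blocks-⊆ (l ∷ L) xs⊆ (u ∷ us)
    with a , b , refl , a⊆ , b⊆ ← ⊆-++-split l (concat L) xs⊆
    with L′ , length-L′ , us′ , refl ← blocks-⊆ L b⊆ us
    = a ∷ L′ , cong suc length-L′ , unique-⊆ a⊆ u ∷ us′ , refl

Blocks-⊆ : ∀ {n m} {xs S : List (Fin n)} → xs ⊆ S → Blocks m S → Blocks m xs
Blocks-⊆ xs⊆S (L , length-L , us , refl) with L′ , length-L′ , us′ , eq ← blocks-⊆ L xs⊆S us =
  L′ , subst (_≤ _) (sym length-L′) length-L , us′ , eq

record Reduction {n} (k b s : ℕ) (S : List (Fin n)) : Set where
  field
    K        : List (Fin n)
    K⊆S      : K ⊆ S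
    K-fresh  : Fresh b (reverse K)
    K-free   : Free (DblPerm (suc k) (suc s)) S → Free (PermDbl (suc k) s) K
    length-S : length S ≤ suc b * (suc k * length K + n * (k + k)) + b

reduction : ∀ {n} k b s → 1 ≤ s → (S : List (Fin n)) → Fresh b (reverse S) → Reduction k b s S
reduction {n} k b s s≥1 S fresh = record
  { K = keptLetters M
  ; K⊆S = subst (keptLetters M ⊆_) lettersM (keptLetters-⊆ M)
  ; K-fresh = greedy-fresh k b c₀ [] S []
  ; K-free = kept-free s s≥1 M spaced ∘ subst (Free (DblPerm (suc k) (suc s))) (sym lettersM)
  ; length-S = begin
        length S
      ≡⟨ cong length lettersM ⟨
        length (letters M)
      ≤⟨ few-blocked b M runs ⟩
        suc b * length (unblockedLetters M) + b
      ≤⟨ +-monoˡ-≤ b (*-monoʳ-≤ (suc b) (unblocked-bound k M spaced)) ⟩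
        suc b * (suc k * length (keptLetters M) + n * (k + k)) + b ∎
  }
  where
  open ≤-Reasoning
  c₀ : Fin n → ℕ
  c₀ _ = 0
  M = greedy k b c₀ [] S
  lettersM : letters M ≡ S
  lettersM = letters-greedy k b c₀ [] S
  spaced : ∀ y → Trace k 0 (marksOf y M)
  spaced = greedy-trace k b c₀ [] S
  runs : Runs b 0 (map proj₂ M)
  runs = greedy-runs k b c₀ [] [] S 0 fresh z≤n z≤n [] λ ()

-- The sequence 0 1 ⋯ n-1 is sparse and avoids Perm^dbl (a pattern that repeats its first letter),
-- so every admissible bound for Perm^dbl is at least n.
allFin-sparse : ∀ w n → Sparse (suc w) (allFin n)
allFin-sparse w n = fresh⇒sparse w (allFin n) (fresh-unique w (allFin⁺ n))

allFin-free : ∀ {k n} s → Free (PermDbl (suc k) s) (allFin n)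
allFin-free s _ (σ₁ , mids , σₗ , perm₁ , permₗ , _ , _ , refl) (f , f-inj , τ⊆) = <⇒≱ twice once
  where
  τ = σ₁ ++ concat mids ++ σₗ
  once : occ (f fzero) (map f τ) ≤ 1
  once = ≤-trans (occ-⊆ (f fzero) τ⊆) (≤-reflexive (occ-allFin (f fzero)))
  twice : 2 ≤ occ (f fzero) (map f τ)
  twice = begin
      2
    ≡⟨ cong₂ _+_ (occ-perm perm₁ fzero) (occ-perm permₗ fzero) ⟨
      occ fzero σ₁ + occ fzero σₗ
    ≤⟨ +-monoʳ-≤ (occ fzero σ₁) (m≤n+m _ _) ⟩
      occ fzero σ₁ + (occ fzero (concat mids) + occ fzero σₗ)
    ≡⟨ trans (occ-++ fzero σ₁ _) (cong (occ fzero σ₁ +_) (occ-++ fzero (concat mids) σₗ)) ⟨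
      occ fzero τ
    ≡⟨ occ-map f f-inj fzero τ ⟨
      occ (f fzero) (map f τ) ∎
    where open ≤-Reasoning

blocks-bound : ∀ k s → 1 ≤ s → (n m K : ℕ) → ExBlocksBound (PermDbl (suc k) s) n m K →
  ExBlocksBound (DblPerm (suc k) (suc s)) n m (suc k * K + 2 * suc k * n)
blocks-bound k s s≥1 n m Kb bound S blocks free = begin
    length S
  ≤⟨ length-S ⟩
    1 * (suc k * length K + n * (k + k)) + 0
  ≡⟨ trans (+-identityʳ _) (*-identityˡ _) ⟩
    suc k * length K + n * (k + k)
  ≤⟨ +-mono-≤ (*-monoʳ-≤ (suc k) (bound K (Blocks-⊆ K⊆S blocks) (K-free free))) alphabet-term ⟩
    suc k * Kb + 2 * suc k * n ∎
  where
  open ≤-Reasoning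
  open Reduction (reduction k 0 s s≥1 S (fresh-0 (reverse S)))
  alphabet-term : n * (k + k) ≤ 2 * suc k * n
  alphabet-term = subst (_≤ 2 * suc k * n) (*-comm (k + k) n)
    (*-monoˡ-≤ n (+-mono-≤ (n≤1+n k) (≤-trans (n≤1+n k) (≤-reflexive (sym (+-identityʳ (suc k)))))))

sparse-constant : ℕ → ℕ
sparse-constant k = suc k * (suc k + (k + k)) + k

sparse-bound : ∀ k s → 1 ≤ s → (n : ℕ) → 1 ≤ n → (K : ℕ) → ExSparseBound (suc k) (PermDbl (suc k) s) n K →
  ExSparseBound (suc k) (DblPerm (suc k) (suc s)) n (sparse-constant k * K)
sparse-bound k s s≥1 n n≥1 Kb bound S sparse free = begin
    length S
  ≤⟨ length-S ⟩
    suc k * (suc k * length K + n * (k + k)) + k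
  ≤⟨ +-mono-≤ (*-monoʳ-≤ (suc k) (+-mono-≤ (*-monoʳ-≤ (suc k) K≤Kb) (*-monoˡ-≤ (k + k) n≤Kb))) k≤k*Kb ⟩
    suc k * (suc k * Kb + Kb * (k + k)) + k * Kb
  ≡⟨ collect k Kb ⟩
    sparse-constant k * Kb ∎
  where
  open ≤-Reasoning
  open Reduction (reduction k k s s≥1 S (fresh-reverse (sparse⇒fresh k S sparse)))
  K≤Kb : length K ≤ Kb
  K≤Kb = bound K (fresh⇒sparse k K (subst (Fresh k) (reverse-involutive K) (fresh-reverse K-fresh))) (K-free free)
  n≤Kb : n ≤ Kb
  n≤Kb = subst (_≤ Kb) (length-allFin n) (bound (allFin n) (allFin-sparse k n) (allFin-free s))
  k≤k*Kb : k ≤ k * Kb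
  k≤k*Kb = ≤-trans (≤-reflexive (sym (*-identityʳ k))) (*-monoʳ-≤ k (≤-trans n≥1 n≤Kb))
  collect : ∀ j K → suc j * (suc j * K + K * (j + j)) + j * K ≡ (suc j * (suc j + (j + j)) + j) * K
  collect = solve-∀

-- Lemma 1.2, for r = k+1 (the argument needs only r ≥ 1).
lemma1p2 : (r s : ℕ) → 2 ≤ r → 1 ≤ s →
    ((n m K : ℕ) → ExBlocksBound (PermDbl r s) n m K →
       ExBlocksBound (DblPerm r (suc s)) n m (r * K + 2 * r * n))
    × (∃ λ C → ∃ λ N → (n : ℕ) → N ≤ n → (K : ℕ) →
       ExSparseBound r (PermDbl r s) n K → ExSparseBound r (DblPerm r (suc s)) n (C * K))
lemma1p2 (suc k) s _ s≥1 = blocks-bound k s s≥1 , (sparse-constant k , 1 , sparse-bound k s s≥1)
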